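{- Let $m$ be a positive integer. If $n=2m$, then $pn(\mathcal{E}_{c}(K_{n}))=m$. If $n=2m+1$, then $m\leq pn(\mathcal{E}_{c}(K_{n}))\leq m+1$.
   Context: $K_n$ denotes the complete graph on $n$ vertices. A book embedding of a graph consists of a linear order of its vertices (along the spine) together with an assignment of each edge to one of finitely many pages, such that no two edges assigned to the same page cross, where edges $ab$ and $cd$ cross iff their endpoints alternate in the linear order. The pagenumber $pn(G)$ is the minimum number of pages over all book embeddings of $G$. For a graph $G$, the complete expansion graph $\mathcal{E}_{c}(G)$ is the graph with vertex set $\{(v,e) : v\in V(G),\ e\in E(G),\ v \text{ is incident with } e\}$ and edge set $E_1\cup E_2$, where $E_1=\{(v,e)(v,f) : v\in V(G),\ e\neq f \in E(G) \text{ both incident with } v\}$ and $E_2=\{(v,e)(w,e) : e=vw\in E(G)\}$ (each vertex $v$ is replaced by a complete graph $K_{d_G(v)}$, and each edge $vw$ of $G$ becomes one edge joining these complete graphs). -}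

module Defs where

open import Data.Nat using (ℕ; _<_; _≤_; _+_)
open import Data.Fin using (Fin; _≟_)
open import Data.Bool using (Bool; not; T)
open import Data.Product using (Σ; Σ-syntax; _×_; ∃-syntax)
open import Data.Sum using (_⊎_)
open import Relation.Nullary using (¬_)
open import Relation.Nullary.Decidable using (⌊_⌋)
open import Relation.Binary.PropositionalEquality using (_≡_; _≢_)
open import Level using (0ℓ; suc)

record Graph : Set₁ where
  field
    Vtx : Set
    Adj : Vtx → Vtx → Set
open Graph public

-- The complete graph K_n on vertex set Fin n: distinct vertices are adjacent.
-- (Adjacency is Bool-valued via T so that proofs of adjacency are unique.)
K : ℕ → Graph
K n = record
  { Vtx = Fin n
  ; Adj = λ x y → T (not ⌊ x ≟ y ⌋)
  }

-- A vertex (v,e) with e = vw an edge incident with v is encoded as the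
-- triple (v , w , proof that vw is an edge).
-- E1: (v,e)(v,f) with e ≠ f, i.e. same v and different other endpoints.
-- E2: (v,e)(w,e) with e = vw.
Ec : Graph → Graph
Ec G = record
  { Vtx = Σ[ v ∈ Vtx G ] Σ[ w ∈ Vtx G ] Adj G v w
  ; Adj = λ { (v , w , _) (v' , w' , _) →
              (v ≡ v' × w ≢ w') ⊎ (v ≡ w' × w ≡ v') }
  }
  where open Data.Product using (_,_)

-- A book embedding of G into k pages: a linear order of the vertices,
-- given by an injective position map into ℕ, and an assignment of a page
-- to each edge, such that no two edges on the same page cross.
Crossing : {A : Set} → (A → ℕ) → A → A → A → A → Set
Crossing pos x y u w = pos x < pos u × pos u < pos y × pos y < pos w

record BookEmbedding (G : Graph) (k : ℕ) : Set where
  field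
    pos       : Vtx G → ℕ
    pos-inj   : ∀ x y → pos x ≡ pos y → x ≡ y
    page      : ∀ x y → Adj G x y → Fin k
    noCross   : ∀ x y u w (a : Adj G x y) (b : Adj G u w) →
                page x y a ≡ page u w b → ¬ Crossing pos x y u w

HasBookEmbedding : Graph → ℕ → Set
HasBookEmbedding G k = BookEmbedding G k

PagenumberIs : Graph → ℕ → Set
PagenumberIs G m = HasBookEmbedding G m × (∀ k → HasBookEmbedding G k → m ≤ k)

PagenumberBetween : Graph → ℕ → ℕ → Set
PagenumberBetween G lo hi =
  HasBookEmbedding G hi × (∀ k → HasBookEmbedding G k → lo ≤ k)

module Submission where

-- The complete expansion graph Ec(K n) replaces each vertex v of K n by a clique on the n-1
-- vertices (v, vw) and keeps the edges of K n as a perfect matching (v, vw) — (w, vw).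
--
-- For n = 2m we place the clique of v as a block of the spine, the blocks in
-- decreasing order of v and each block in the cyclic order w = v+1, …, n-1, 0, …, v-1.  A clique
-- edge (v,vw)(v,vw′) goes to page ⌊(w+w′)/2⌋ mod m and a matching edge to ⌊(v+w)/2⌋ mod m.  This is
-- the classical zig-zag m-page embedding of K_{2m} (lemma zigzag), and after shifting labels by
-- the block index (half-mod-shift, half-mod-period) every pair of crossing edges reduces to it.
-- The odd case embeds Ec(K_{2m+1}) into Ec(K_{2m+2}) (restrict).
--
-- The clique at a vertex of Ec(K_{N+1}) is a K_N, so pn(Ec(K_{N+1})) ≥ pn(K_N);
-- read along the spine (spine-book), K_{2M} needs M pages (clique-even) and K_{2M+1} needs M+1
-- pages for M ≥ 2 (clique-odd).  The remaining case Ec(K_4) is 3-regular and therefore has no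
-- one-page embedding (OnePage.no-one-page).

open import Data.Nat
open import Data.Nat.Properties
open import Data.Nat.DivMod using (_%_; _mod_; m≡m%n+[m/n]*n; [m+kn]%n≡m%n; %-distribˡ-+)
open import Data.Nat.Divisibility using (divides; ∣⇒≤)
open import Data.Nat.Tactic.RingSolver using (solve-∀)
open import Algebra.Properties.CommutativeSemigroup +-commutativeSemigroup using (interchange)
open import Data.Fin as Fin using (Fin; zero; suc; toℕ; fromℕ<; inject≤; punchIn; punchOut)
open import Data.Fin.Properties
  using (toℕ-injective; toℕ<n; toℕ-fromℕ<; inject≤-injective; punchIn-injective; punchInᵢ≢i;
         punchIn-punchOut; pigeonhole; injective⇒≤)
  renaming (suc-injective to fin-suc-injective)
open import Data.Product using (Σ-syntax; _×_; _,_; proj₁; proj₂)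
open import Data.Sum using (_⊎_; inj₁; inj₂)
open import Data.Empty using (⊥; ⊥-elim)
open import Data.Bool.Properties using (T-irrelevant)
open import Function using (_∘_)
open import Relation.Nullary using (¬_; yes; no)
open import Relation.Nullary.Decidable using (toWitnessFalse; fromWitnessFalse; recompute; T?)
open import Relation.Binary.PropositionalEquality
open import Relation.Binary.Definitions using (tri<; tri≈; tri>)
open import Defs

half-shift : ∀ c s → ⌊ (c + c) + s /2⌋ ≡ c + ⌊ s /2⌋
half-shift zero    s = refl
half-shift (suc c) s rewrite +-suc c c = cong suc (half-shift c s)

close-residues : ∀ m .{{_ : NonZero m}} {X Y} → X < Y → Y < m + X → X % m ≢ Y % m
close-residues m {X} {Y} X<Y Y<m+X same = <⇒≱ Y<m+X m+X≤Y
  where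
  open ≤-Reasoning
  gap-multiple : Y ∸ X ≡ (Y / m ∸ X / m) * m
  gap-multiple = begin-equality
    Y ∸ X                                   ≡⟨ cong₂ _∸_ (m≡m%n+[m/n]*n Y m) (m≡m%n+[m/n]*n X m) ⟩
    (Y % m + Y / m * m) ∸ (X % m + X / m * m) ≡⟨ cong (λ r → (r + Y / m * m) ∸ (X % m + X / m * m)) (sym same) ⟩
    (X % m + Y / m * m) ∸ (X % m + X / m * m) ≡⟨ [m+n]∸[m+o]≡n∸o (X % m) (Y / m * m) (X / m * m) ⟩
    Y / m * m ∸ X / m * m                   ≡⟨ *-distribʳ-∸ m (Y / m) (X / m) ⟨
    (Y / m ∸ X / m) * m                     ∎
  m≤gap : m ≤ Y ∸ X
  m≤gap = ∣⇒≤ {{>-nonZero (m<n⇒0<n∸m X<Y)}} (divides (Y / m ∸ X / m) gap-multiple)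
  m+X≤Y : m + X ≤ Y
  m+X≤Y = begin
    m + X       ≤⟨ +-monoˡ-≤ X m≤gap ⟩
    Y ∸ X + X   ≡⟨ m∸n+n≡m (<⇒≤ X<Y) ⟩
    Y           ∎

-- The zig-zag page assignment of K_{2m}: with the vertices 0 < 1 < … < 2m-1 on the spine,
-- the edge {a, b} goes to page ⌊(a+b)/2⌋ mod m.  Alternating edges get different pages.
zigzag : ∀ m .{{_ : NonZero m}} {a b c d} → a < c → c < b → b < d → d < m + m →
         ⌊ a + b /2⌋ % m ≢ ⌊ c + d /2⌋ % m
zigzag m {a} {b} {c} {d} a<c c<b b<d d<2m = close-residues m halves-< halves-close
  where
  open ≤-Reasoning
  -- the two sums are at least 2 and at most 2m-2 apart
  sums-apart : suc (suc (a + b)) ≤ c + d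
  sums-apart = begin
    suc (suc (a + b)) ≡⟨ cong suc (+-suc a b) ⟨
    suc a + suc b     ≤⟨ +-mono-≤ a<c b<d ⟩
    c + d             ∎
  sums-close : suc (suc (c + d)) ≤ (m + m) + (a + b)
  sums-close = begin
    suc (suc (c + d)) ≡⟨ cong suc (+-suc c d) ⟨
    suc c + suc d     ≤⟨ +-mono-≤ c<b d<2m ⟩
    b + (m + m)       ≡⟨ +-comm b (m + m) ⟩
    (m + m) + b       ≤⟨ +-monoʳ-≤ (m + m) (m≤n+m b a) ⟩
    (m + m) + (a + b) ∎
  halves-< : ⌊ a + b /2⌋ < ⌊ c + d /2⌋
  halves-< = ⌊n/2⌋-mono sums-apart
  halves-close : ⌊ c + d /2⌋ < m + ⌊ a + b /2⌋
  halves-close = subst (⌊ c + d /2⌋ <_) (half-shift m (a + b)) (⌊n/2⌋-mono sums-close)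

half-mod-period : ∀ m .{{_ : NonZero m}} k t → ⌊ k * (m + m) + t /2⌋ % m ≡ ⌊ t /2⌋ % m
half-mod-period m k t = begin
  ⌊ k * (m + m) + t /2⌋ % m       ≡⟨ cong (λ s → ⌊ s + t /2⌋ % m) (*-distribˡ-+ k m m) ⟩
  ⌊ (k * m + k * m) + t /2⌋ % m   ≡⟨ cong (_% m) (half-shift (k * m) t) ⟩
  (k * m + ⌊ t /2⌋) % m           ≡⟨ cong (_% m) (+-comm (k * m) ⌊ t /2⌋) ⟩
  (⌊ t /2⌋ + k * m) % m           ≡⟨ [m+kn]%n≡m%n ⌊ t /2⌋ k m ⟩
  ⌊ t /2⌋ % m                     ∎
  where open ≡-Reasoning

half-mod-shift : ∀ m .{{_ : NonZero m}} c {s s′} → ⌊ s /2⌋ % m ≡ ⌊ s′ /2⌋ % m →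
                 ⌊ (c + c) + s /2⌋ % m ≡ ⌊ (c + c) + s′ /2⌋ % m
half-mod-shift m c {s} {s′} same = begin
  ⌊ (c + c) + s /2⌋ % m             ≡⟨ cong (_% m) (half-shift c s) ⟩
  (c + ⌊ s /2⌋) % m                 ≡⟨ %-distribˡ-+ c ⌊ s /2⌋ m ⟩
  (c % m + ⌊ s /2⌋ % m) % m         ≡⟨ cong (λ r → (c % m + r) % m) same ⟩
  (c % m + ⌊ s′ /2⌋ % m) % m        ≡⟨ %-distribˡ-+ c ⌊ s′ /2⌋ m ⟨
  (c + ⌊ s′ /2⌋) % m                ≡⟨ cong (_% m) (half-shift c s′) ⟨
  ⌊ (c + c) + s′ /2⌋ % m            ∎
  where open ≡-Reasoning

lex-< : ∀ n {b b′ a a′} → b < b′ → a < n → n * b + a < n * b′ + a′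
lex-< n {b} {b′} {a} {a′} b<b′ a<n = begin-strict
  n * b + a   <⟨ +-monoʳ-< (n * b) a<n ⟩
  n * b + n   ≡⟨ +-comm (n * b) n ⟩
  n + n * b   ≡⟨ *-suc n b ⟨
  n * suc b   ≤⟨ *-monoʳ-≤ n b<b′ ⟩
  n * b′      ≤⟨ m≤m+n (n * b′) a′ ⟩
  n * b′ + a′ ∎
  where open ≤-Reasoning

lex-block : ∀ n {b b′ a a′} → a′ < n → n * b + a < n * b′ + a′ → b ≤ b′
lex-block n a′<n lt = ≮⇒≥ (λ b′<b → <-asym lt (lex-< n b′<b a′<n))

lex-injective : ∀ n {b b′ a a′} → a < n → a′ < n → n * b + a ≡ n * b′ + a′ → b ≡ b′ × a ≡ a′
lex-injective n {b} {b′} a<n a′<n eq with <-cmp b b′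
... | tri< b<b′ _ _ = ⊥-elim (<-irrefl eq (lex-< n b<b′ a<n))
... | tri≈ _ refl _ = refl , +-cancelˡ-≡ (n * b) _ _ eq
... | tri> _ _ b′<b = ⊥-elim (<-irrefl (sym eq) (lex-< n b′<b a′<n))

K-distinct : ∀ {n} {v w : Fin n} → Adj (K n) v w → v ≢ w
K-distinct = toWitnessFalse

K-adjacent : ∀ {n} {v w : Fin n} → v ≢ w → Adj (K n) v w
K-adjacent = fromWitnessFalse

Ec-vertex-≡ : ∀ {n} (x y : Vtx (Ec (K n))) →
              proj₁ x ≡ proj₁ y → proj₁ (proj₂ x) ≡ proj₁ (proj₂ y) → x ≡ y
Ec-vertex-≡ (v , w , p) (.v , .w , q) refl refl = cong (λ r → v , w , r) (T-irrelevant p q)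

Ec-sym : ∀ {n} (x y : Vtx (Ec (K n))) → Adj (Ec (K n)) x y → Adj (Ec (K n)) y x
Ec-sym _ _ (inj₁ (same , differ)) = inj₁ (sym same , differ ∘ sym)
Ec-sym _ _ (inj₂ (vw , wv))       = inj₂ (sym wv , sym vw)

Ec-irrefl : ∀ {n} (x : Vtx (Ec (K n))) → ¬ Adj (Ec (K n)) x x
Ec-irrefl x             (inj₁ (_ , differ)) = differ refl
Ec-irrefl (v , w , vw) (inj₂ (v≡w , _))    = K-distinct vw v≡w

record _⊆_ (G H : Graph) : Set where
  field
    embed     : Vtx G → Vtx H
    injective : ∀ x y → embed x ≡ embed y → x ≡ y
    adjacent  : ∀ {x y} → Adj G x y → Adj H (embed x) (embed y)

restrict : ∀ {G H k} → G ⊆ H → BookEmbedding H k → BookEmbedding G k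
restrict {G} sub E = record
  { pos     = pos ∘ embed
  ; pos-inj = λ x y eq → injective x y (pos-inj _ _ eq)
  ; page    = λ x y a → page _ _ (adjacent a)
  ; noCross = λ x y u w a b → noCross _ _ _ _ (adjacent a) (adjacent b)
  }
  where
  open _⊆_ sub
  open BookEmbedding E

vertex-clique : ∀ N → K N ⊆ Ec (K (suc N))
vertex-clique N = record
  { embed     = λ i → zero , suc i , K-adjacent {v = zero} {suc i} (λ ())
  ; injective = λ i j eq → fin-suc-injective (cong (proj₁ ∘ proj₂) eq)
  ; adjacent  = λ a → inj₁ (refl , K-distinct a ∘ fin-suc-injective)
  }

Ec-K-mono : ∀ {n n′} → n ≤ n′ → Ec (K n) ⊆ Ec (K n′)
Ec-K-mono {n} {n′} n≤n′ = record
  { embed     = embed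
  ; injective = λ x y eq → Ec-vertex-≡ x y (ι-injective (cong proj₁ eq)) (ι-injective (cong (proj₁ ∘ proj₂) eq))
  ; adjacent  = λ { (inj₁ (same , differ)) → inj₁ (cong ι same , differ ∘ ι-injective)
                  ; (inj₂ (vw , wv))       → inj₂ (cong ι vw , cong ι wv) }
  }
  where
  ι : Fin n → Fin n′
  ι i = inject≤ i n≤n′
  ι-injective : ∀ {i j} → ι i ≡ ι j → i ≡ j
  ι-injective = inject≤-injective n≤n′ n≤n′ _ _
  embed : Vtx (Ec (K n)) → Vtx (Ec (K n′))
  embed (v , w , vw) = ι v , ι w , K-adjacent (K-distinct vw ∘ ι-injective)

-- A chord of the spine 0 < 1 < … < N-1: a pair of spine ranks lo < hi < N.
-- (The bounds are irrelevant, so a chord is determined by its endpoints.)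
record Chord (N : ℕ) : Set where
  constructor chord
  field
    lo hi : ℕ
    .lo<hi : lo < hi
    .hi<N  : hi < N
open Chord

Alternate : ∀ {N} → Chord N → Chord N → Set
Alternate e f = lo e < lo f × lo f < hi e × hi e < hi f

record SpineBook (N k : ℕ) : Set where
  field
    page    : Chord N → Fin k
    noCross : ∀ e f → Alternate e f → page e ≢ page f

argmin : ∀ {N} (f : Fin (suc N) → ℕ) → Σ[ i ∈ Fin (suc N) ] (∀ j → f i ≤ f j)
argmin {zero}  f = zero , λ { zero → ≤-refl }
argmin {suc N} f with argmin (f ∘ suc)
... | i , min with f zero ≤? f (suc i)
...   | yes f0≤ = zero  , λ { zero → ≤-refl ; (suc j) → ≤-trans f0≤ (min j) }
...   | no  f0≰ = suc i , λ { zero → <⇒≤ (≰⇒> f0≰) ; (suc j) → min j }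

sort : ∀ N (f : Fin N → ℕ) → (∀ i j → f i ≡ f j → i ≡ j) →
       Σ[ g ∈ (Fin N → Fin N) ] (∀ {i j} → i Fin.< j → f (g i) < f (g j))
sort zero    f f-inj = (λ ()) , λ { {()} }
sort (suc N) f f-inj with argmin f
... | i₀ , min with sort N (f ∘ punchIn i₀) (λ i j eq → punchIn-injective i₀ i j (f-inj _ _ eq))
... | g , increasing = g′ , increasing′
  where
  g′ : Fin (suc N) → Fin (suc N)
  g′ zero    = i₀
  g′ (suc i) = punchIn i₀ (g i)
  increasing′ : ∀ {i j} → i Fin.< j → f (g′ i) < f (g′ j)
  increasing′ {zero}  {suc j} _         = ≤∧≢⇒< (min _) (punchInᵢ≢i i₀ (g j) ∘ sym ∘ f-inj _ _)
  increasing′ {suc i} {suc j} (s≤s i<j) = increasing i<j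

spine-book : ∀ {N k} → BookEmbedding (K N) k → SpineBook N k
spine-book {N} {k} E = record { page = page′ ; noCross = noCross′ }
  where
  open BookEmbedding E
  sorted = sort N pos pos-inj
  at : ∀ r → .(r < N) → Fin N
  at r r<N = proj₁ sorted (fromℕ< r<N)
  ordered : ∀ {r s} .(r<N : r < N) .(s<N : s < N) → r < s → pos (at r r<N) < pos (at s s<N)
  ordered r<N s<N r<s = proj₂ sorted (subst₂ _<_ (sym (toℕ-fromℕ< r<N)) (sym (toℕ-fromℕ< s<N)) r<s)
  page′ : Chord N → Fin k
  page′ (chord a b a<b b<N) =
    page _ _ (recompute (T? _) (K-adjacent (λ eq → <-irrefl (cong pos eq) (ordered (<-trans a<b b<N) b<N a<b))))
  noCross′ : ∀ e f → Alternate e f → page′ e ≢ page′ f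
  noCross′ (chord a b a<b b<N) (chord c d c<d d<N) (a<c , c<b , b<d) same =
    noCross _ _ _ _ _ _ same ( ordered (<-trans a<b b<N) (<-trans c<d d<N) a<c
                             , ordered (<-trans c<d d<N) b<N c<b
                             , ordered b<N d<N b<d )

chord-≡ : ∀ {N} {e f : Chord N} → lo e ≡ lo f → hi e ≡ hi f → e ≡ f
chord-≡ {e = chord a b _ _} {chord .a .b _ _} refl refl = refl

alternating⇒≤ : ∀ {N k r} → SpineBook N k → (c : Fin r → Chord N) →
                (∀ {i j} → i Fin.< j → Alternate (c i) (c j)) → r ≤ k
alternating⇒≤ B c alt = injective⇒≤ injective
  where
  open SpineBook B
  injective : ∀ {i j} → page (c i) ≡ page (c j) → i ≡ j
  injective {i} {j} same with <-cmp (toℕ i) (toℕ j)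
  ... | tri< i<j _ _ = ⊥-elim (noCross _ _ (alt i<j) same)
  ... | tri≈ _ i≡j _ = toℕ-injective i≡j
  ... | tri> _ _ j<i = ⊥-elim (noCross _ _ (alt j<i) (sym same))

-- pn(K_{2M}) ≥ M: the M diameters (i, i+M) pairwise alternate.
clique-even : ∀ {M k} → SpineBook (M + M) k → M ≤ k
clique-even {M} B = alternating⇒≤ B diameter alternate
  where
  diameter : Fin M → Chord (M + M)
  diameter i = chord (toℕ i) (toℕ i + M) (m<m+n (toℕ i) (≤-trans (s≤s z≤n) (toℕ<n i))) (+-monoˡ-< M (toℕ<n i))
  alternate : ∀ {i j} → i Fin.< j → Alternate (diameter i) (diameter j)
  alternate {i} {j} i<j = i<j , <-≤-trans (toℕ<n j) (m≤n+m M (toℕ i)) , +-monoˡ-< M i<j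

-- pn(K_{2M+1}) ≥ M+1 for M ≥ 2.  Assuming only k ≤ M pages, two pigeonhole arguments force the
-- chords (0, M), (M, 2M) and (M-1, 2M) onto a common page; but (0, M) and (M-1, 2M) alternate.
module OddClique {M-1 k : ℕ} (0<M-1 : 0 < M-1) (B : SpineBook (suc (suc M-1 + suc M-1)) k)
                 (few : k < suc (suc M-1)) where
  open SpineBook B
  M : ℕ
  M = suc M-1

  first last : Chord (suc (M + M))
  first = chord 0 M (s≤s z≤n) (s≤s (m≤m+n M M))
  last  = chord M (M + M) (m<m+n M (s≤s z≤n)) ≤-refl

  diameter : Fin (suc M) → Chord (suc (M + M))
  diameter i = chord (toℕ i) (toℕ i + M) (m<m+n (toℕ i) (s≤s z≤n)) (s≤s (+-monoˡ-≤ M (s≤s⁻¹ (toℕ<n i))))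

  skew : Fin (suc M) → Chord (suc (M + M))
  skew zero    = last
  skew (suc i) = chord (toℕ i) (toℕ i + suc M) (m<m+n (toℕ i) (s≤s z≤n))
                       (subst (_< suc (M + M)) (sym (+-suc (toℕ i) M)) (s≤s (+-monoˡ-< M (toℕ<n i))))

  -- only the first and the last diameter do not alternate, so they share a page
  first≈last : page first ≡ page last
  first≈last with pigeonhole few (page ∘ diameter)
  ... | i , j , i<j , same with toℕ j <? toℕ i + M
  ...   | yes j<i+M = ⊥-elim (noCross _ _ (i<j , j<i+M , +-monoˡ-< M i<j) same)
  ...   | no  j≮i+M = trans (cong page (chord-≡ (sym i≡0) (cong (_+ M) (sym i≡0))))
                            (trans same (cong page (chord-≡ j≡M (cong (_+ M) j≡M))))
    where
    i+M≤j : toℕ i + M ≤ toℕ j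
    i+M≤j = ≮⇒≥ j≮i+M
    j≤M : toℕ j ≤ M
    j≤M = s≤s⁻¹ (toℕ<n j)
    i≡0 : toℕ i ≡ 0
    i≡0 = n≤0⇒n≡0 (+-cancelʳ-≤ M (toℕ i) 0 (≤-trans i+M≤j j≤M))
    j≡M : toℕ j ≡ M
    j≡M = ≤-antisym j≤M (≤-trans (m≤n+m M (toℕ i)) i+M≤j)

  -- among the skew chords only (M-1, 2M) and the last diameter do not alternate
  penultimate : Chord (suc (M + M))
  penultimate = chord M-1 (M-1 + suc M) (m<m+n M-1 (s≤s z≤n)) (subst (_< suc (M + M)) (sym (+-suc M-1 M)) ≤-refl)

  penultimate≈last : page penultimate ≡ page last
  penultimate≈last with pigeonhole few (page ∘ skew)
  ... | zero  , zero  , () , _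
  ... | suc _ , zero  , () , _
  ... | suc i , suc j , s≤s i<j , same =
    ⊥-elim (noCross _ _ (i<j , <-≤-trans (toℕ<n j) (≤-trans (n≤1+n M) (m≤n+m (suc M) (toℕ i))) , +-monoˡ-< (suc M) i<j) same)
  ... | zero  , suc j , _ , same with suc (toℕ j) <? M
  ...   | yes j+1<M = ⊥-elim (noCross _ _ (toℕ<n j , <-≤-trans (n<1+n M) (m≤n+m (suc M) (toℕ j)) , j+M+1<2M) (sym same))
    where
    j+M+1<2M : toℕ j + suc M < M + M
    j+M+1<2M = subst (_< M + M) (sym (+-suc (toℕ j) M)) (+-monoˡ-< M j+1<M)
  ...   | no  j+1≮M = trans (cong page (chord-≡ M-1≡j (cong (_+ suc M) M-1≡j))) (sym same)
    where
    M-1≡j : M-1 ≡ toℕ j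
    M-1≡j = ≤-antisym (≮⇒≥ (j+1≮M ∘ s≤s)) (s≤s⁻¹ (toℕ<n j))

  impossible : ⊥
  impossible = noCross first penultimate (0<M-1 , n<1+n M-1 , <-≤-trans (n<1+n M) (m≤n+m (suc M) M-1))
                       (trans first≈last (sym penultimate≈last))

clique-odd : ∀ {M k} → 2 ≤ M → SpineBook (suc (M + M)) k → suc M ≤ k
clique-odd {suc M-1} {k} (s≤s 0<M-1) B with suc (suc M-1) ≤? k
... | yes enough = enough
... | no  few    = ⊥-elim (OddClique.impossible 0<M-1 B (≰⇒> few))

record ThreeNeighbours (G : Graph) (x : Vtx G) : Set where
  field
    t₁ t₂ t₃       : Vtx G
    adj₁           : Adj G x t₁
    adj₂           : Adj G x t₂
    adj₃           : Adj G x t₃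
    t₁≢t₂          : t₁ ≢ t₂
    t₁≢t₃          : t₁ ≢ t₃
    t₂≢t₃          : t₂ ≢ t₃

-- One-page graphs are outerplanar, hence have a vertex of degree ≤ 2: a graph in which every
-- vertex has three distinct neighbours has no one-page book embedding.  In a one-page
-- embedding every edge spans an empty interval of the spine (induction on its length); then
-- a vertex has at most one neighbour on each side.
module OnePage (G : Graph) (symmetric : ∀ x y → Adj G x y → Adj G y x)
               (irreflexive : ∀ x → ¬ Adj G x x) (E : BookEmbedding G 1) where
  open BookEmbedding E

  Gap : Vtx G → Vtx G → Set
  Gap x y = ∀ w → pos x < pos w → pos w < pos y → ⊥

  gap-trivial : ∀ {x y} → pos y ≤ pos x → Gap x y
  gap-trivial y≤x w xw wy = <⇒≱ (<-trans xw wy) y≤x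

  Side : Vtx G → Vtx G → Set
  Side u t = pos u < pos t ⊎ pos t < pos u

  side : ∀ u t → Adj G u t → Side u t
  side u t a with <-cmp (pos u) (pos t)
  ... | tri< u<t _ _ = inj₁ u<t
  ... | tri≈ _ u≡t _ = ⊥-elim (irreflexive u (subst (Adj G u) (sym (pos-inj u t u≡t)) a))
  ... | tri> _ _ t<u = inj₂ t<u

  right-unique : ∀ {u t t′} → pos u < pos t → pos u < pos t′ → Gap u t → Gap u t′ → t ≡ t′
  right-unique {u} {t} {t′} ut ut′ gap gap′ with <-cmp (pos t) (pos t′)
  ... | tri< t<t′ _ _ = ⊥-elim (gap′ t ut t<t′)
  ... | tri≈ _ t≡t′ _ = pos-inj t t′ t≡t′
  ... | tri> _ _ t′<t = ⊥-elim (gap t′ ut′ t′<t)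

  left-unique : ∀ {u t t′} → pos t < pos u → pos t′ < pos u → Gap t u → Gap t′ u → t ≡ t′
  left-unique {u} {t} {t′} tu t′u gap gap′ with <-cmp (pos t) (pos t′)
  ... | tri< t<t′ _ _ = ⊥-elim (gap t′ t<t′ t′u)
  ... | tri≈ _ t≡t′ _ = pos-inj t t′ t≡t′
  ... | tri> _ _ t′<t = ⊥-elim (gap′ t t′<t tu)

  Tight : Vtx G → Set
  Tight u = ∀ t → Adj G u t → Gap u t × Gap t u

  crowded : ∀ u → ThreeNeighbours G u → ¬ Tight u
  crowded u three tight = sides (side u t₁ adj₁) (side u t₂ adj₂) (side u t₃ adj₃)
    where
    open ThreeNeighbours three
    right : ∀ {t t′} → Adj G u t → Adj G u t′ → pos u < pos t → pos u < pos t′ → t ≡ t′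
    right a a′ ut ut′ = right-unique ut ut′ (proj₁ (tight _ a)) (proj₁ (tight _ a′))
    left : ∀ {t t′} → Adj G u t → Adj G u t′ → pos t < pos u → pos t′ < pos u → t ≡ t′
    left a a′ tu t′u = left-unique tu t′u (proj₂ (tight _ a)) (proj₂ (tight _ a′))
    sides : Side u t₁ → Side u t₂ → Side u t₃ → ⊥
    sides (inj₁ r₁) (inj₁ r₂) _         = t₁≢t₂ (right adj₁ adj₂ r₁ r₂)
    sides (inj₂ l₁) (inj₂ l₂) _         = t₁≢t₂ (left adj₁ adj₂ l₁ l₂)
    sides (inj₁ r₁) (inj₂ _)  (inj₁ r₃) = t₁≢t₃ (right adj₁ adj₃ r₁ r₃)
    sides (inj₂ l₁) (inj₁ _)  (inj₂ l₃) = t₁≢t₃ (left adj₁ adj₃ l₁ l₃)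
    sides (inj₁ _)  (inj₂ l₂) (inj₂ l₃) = t₂≢t₃ (left adj₂ adj₃ l₂ l₃)
    sides (inj₂ _)  (inj₁ r₂) (inj₁ r₃) = t₂≢t₃ (right adj₂ adj₃ r₂ r₃)

  same-page : ∀ (p q : Fin 1) → p ≡ q
  same-page zero zero = refl

  module _ (three : ∀ x → ThreeNeighbours G x) where
    gap-bounded : ∀ b x y → Adj G x y → pos y ∸ pos x < b → Gap x y
    gap-bounded (suc b) x y a short w xw wy = crowded w (three w) tight
      where
      -- a neighbour of w outside [x, y] would yield an edge crossing xy
      below-y : ∀ {t} → Adj G w t → pos t ≤ pos y
      below-y at = ≮⇒≥ (λ y<t → noCross x y w _ a at (same-page _ _) (xw , wy , y<t))
      above-x : ∀ {t} → Adj G w t → pos x ≤ pos t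
      above-x at = ≮⇒≥ (λ t<x → noCross _ w x y (symmetric w _ at) a (same-page _ _) (t<x , xw , wy))
      -- so the edges at w are shorter than xy
      tight : Tight w
      tight t at with side w t at
      ... | inj₁ w<t = gap-bounded b w t at (begin-strict
              pos t ∸ pos w ≤⟨ ∸-monoˡ-≤ (pos w) (below-y at) ⟩
              pos y ∸ pos w <⟨ ∸-monoʳ-< xw (<⇒≤ wy) ⟩
              pos y ∸ pos x ≤⟨ s≤s⁻¹ short ⟩
              b             ∎)
                     , gap-trivial (<⇒≤ w<t)
        where open ≤-Reasoning
      ... | inj₂ t<w = gap-trivial (<⇒≤ t<w)
                     , gap-bounded b t w (symmetric w t at) (begin-strict
              pos w ∸ pos t ≤⟨ ∸-monoʳ-≤ (pos w) (above-x at) ⟩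
              pos w ∸ pos x <⟨ ∸-monoˡ-< wy (<⇒≤ xw) ⟩
              pos y ∸ pos x ≤⟨ s≤s⁻¹ short ⟩
              b             ∎)
        where open ≤-Reasoning

    gap : ∀ x y → Adj G x y → Gap x y
    gap x y a = gap-bounded (suc (pos y ∸ pos x)) x y a ≤-refl

    no-one-page : Vtx G → ⊥
    no-one-page u = crowded u (three u) (λ t a → gap u t a , gap t u (symmetric u t a))

-- Every vertex (v, vw) of Ec(K (4+n)) has the three distinct neighbours (v, va₁), (v, va₂)
-- and (w, wv), where a₁, a₂ are two vertices of K (4+n) different from v and w.
Ec-three-neighbours : ∀ n x → ThreeNeighbours (Ec (K (4 + n))) x
Ec-three-neighbours n (v , w , vw) = record
  { t₁ = v , other zero , K-adjacent (v≢other zero)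
  ; t₂ = v , other (suc zero) , K-adjacent (v≢other (suc zero))
  ; t₃ = w , v , K-adjacent (v≢w ∘ sym)
  ; adj₁ = inj₁ (refl , w≢other zero)
  ; adj₂ = inj₁ (refl , w≢other (suc zero))
  ; adj₃ = inj₂ (refl , refl)
  ; t₁≢t₂ = (λ ()) ∘ other-injective ∘ cong (proj₁ ∘ proj₂)
  ; t₁≢t₃ = v≢w ∘ cong proj₁
  ; t₂≢t₃ = v≢w ∘ cong proj₁
  }
  where
  v≢w : v ≢ w
  v≢w = K-distinct vw
  -- w = punchIn v w′, and the vertices other than v and w are punchIn v (punchIn w′ a)
  w′ : Fin (3 + n)
  w′ = punchOut v≢w
  other : Fin (2 + n) → Fin (4 + n)
  other a = punchIn v (punchIn w′ a)
  other-injective : ∀ {a b} → other a ≡ other b → a ≡ b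
  other-injective = punchIn-injective w′ _ _ ∘ punchIn-injective v _ _
  v≢other : ∀ a → v ≢ other a
  v≢other a = punchInᵢ≢i v _ ∘ sym
  w≢other : ∀ a → w ≢ other a
  w≢other a eq = punchInᵢ≢i w′ a (sym (punchIn-injective v _ _ (trans (punchIn-punchOut v≢w) eq)))

edge⇒page : ∀ {G k x y} → Adj G x y → BookEmbedding G k → 1 ≤ k
edge⇒page {k = zero}  a E with BookEmbedding.page E _ _ a
... | ()
edge⇒page {k = suc _} _ _ = s≤s z≤n

corner corner′ : ∀ n → Vtx (Ec (K (2 + n)))
corner  n = zero , suc zero , K-adjacent {2 + n} {zero} {suc zero} (λ ())
corner′ n = suc zero , zero , K-adjacent {2 + n} {suc zero} {zero} (λ ())

Ec-edge : ∀ n → Adj (Ec (K (2 + n))) (corner n) (corner′ n)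
Ec-edge n = inj₂ (refl , refl)

Ec-two-pages : ∀ n k → BookEmbedding (Ec (K (4 + n))) k → 2 ≤ k
Ec-two-pages n zero          E = ⊥-elim (<⇒≱ (edge⇒page (Ec-edge (2 + n)) E) z≤n)
Ec-two-pages n (suc zero)    E =
  ⊥-elim (OnePage.no-one-page (Ec (K (4 + n))) Ec-sym Ec-irrefl E (Ec-three-neighbours n) (corner (2 + n)))
Ec-two-pages n (suc (suc k)) E = s≤s (s≤s z≤n)

-- The m-page book embedding of Ec(K_{2m}), written for m = m-1 + 1.  A vertex (V, VW) sits at
-- position n * β V + offset V W; its page is read off the label sums of K n described above.
module EvenEmbedding (m-1 : ℕ) where
  m n n-1 : ℕ
  m   = suc m-1
  n   = m + m
  n-1 = pred n

  Pg : ℕ → ℕ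
  Pg s = ⌊ s /2⌋ % m

  -- The vertices V of K n occupy the blocks β V of the spine in decreasing order.
  β : ℕ → ℕ
  β V = n-1 ∸ V

  β-complement : ∀ {V} → V ≤ n-1 → V + β V ≡ n-1
  β-complement = m+[n∸m]≡n

  β-antitone : ∀ {V V′} → V < V′ → V′ ≤ n-1 → β V′ < β V
  β-antitone = ∸-monoʳ-<

  β-reflects : ∀ {V V′} → V′ ≤ n-1 → β V ≤ β V′ → V′ ≤ V
  β-reflects V′≤ βV≤βV′ = ≮⇒≥ (λ V<V′ → <⇒≱ (β-antitone V<V′ V′≤) βV≤βV′)

  β-injective : ∀ {V V′} → V ≤ n-1 → V′ ≤ n-1 → β V ≡ β V′ → V ≡ V′
  β-injective V≤ V′≤ eq = ≤-antisym (β-reflects V≤ (≤-reflexive (sym eq))) (β-reflects V′≤ (≤-reflexive eq))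

  -- Inside block V the vertices (V, W) follow the cyclic order W = V+1, …, n-1, 0, …, V-1.
  offset : ℕ → ℕ → ℕ
  offset V W with V <? W
  ... | yes _ = W ∸ suc V
  ... | no  _ = W + β V

  offset-after : ∀ {V W} → V < W → suc V + offset V W ≡ W
  offset-after {V} {W} V<W with V <? W
  ... | yes _    = m+[n∸m]≡n V<W
  ... | no  V≮W = ⊥-elim (V≮W V<W)

  offset-before : ∀ {V W} → W < V → offset V W ≡ W + β V
  offset-before {V} {W} W<V with V <? W
  ... | yes V<W = ⊥-elim (<-asym V<W W<V)
  ... | no  _   = refl

  offset-after<β : ∀ {V W} → V < W → W ≤ n-1 → offset V W < β V
  offset-after<β {V} {W} V<W W≤ = +-cancelˡ-≤ V _ _ (begin
    V + suc (offset V W) ≡⟨ +-suc V (offset V W) ⟩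
    suc V + offset V W   ≡⟨ offset-after V<W ⟩
    W                    ≤⟨ W≤ ⟩
    n-1                  ≡⟨ β-complement (≤-trans (<⇒≤ V<W) W≤) ⟨
    V + β V              ∎)
    where open ≤-Reasoning

  β≤offset-before : ∀ {V W} → W < V → β V ≤ offset V W
  β≤offset-before {V} {W} W<V = subst (β V ≤_) (sym (offset-before W<V)) (m≤n+m (β V) W)

  offset<n-1 : ∀ {V W} → V ≤ n-1 → W ≤ n-1 → V ≢ W → offset V W < n-1
  offset<n-1 {V} {W} V≤ W≤ V≢W with <-cmp V W
  ... | tri< V<W _ _ = <-≤-trans (offset-after<β V<W W≤) (m∸n≤m n-1 V)
  ... | tri≈ _ V≡W _ = ⊥-elim (V≢W V≡W)
  ... | tri> _ _ W<V = begin-strict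
    offset V W ≡⟨ offset-before W<V ⟩
    W + β V    <⟨ +-monoˡ-< (β V) W<V ⟩
    V + β V    ≡⟨ β-complement V≤ ⟩
    n-1        ∎
    where open ≤-Reasoning

  offset-mod : ∀ {V W} → V ≤ n-1 → V ≢ W → Σ[ k ∈ ℕ ] β V + W ≡ k * n + offset V W
  offset-mod {V} {W} V≤ V≢W with <-cmp V W
  ... | tri< V<W _ _ = 1 , (begin
    β V + W                  ≡⟨ cong (β V +_) (offset-after V<W) ⟨
    β V + (suc V + offset V W) ≡⟨ +-assoc (β V) (suc V) (offset V W) ⟨
    (β V + suc V) + offset V W ≡⟨ cong (_+ offset V W) β+suc ⟩
    n + offset V W           ≡⟨ cong (_+ offset V W) (*-identityˡ n) ⟨
    1 * n + offset V W       ∎)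
    where
    open ≡-Reasoning
    β+suc : β V + suc V ≡ n
    β+suc = trans (+-suc (β V) V) (cong suc (trans (+-comm (β V) V) (β-complement V≤)))
  ... | tri≈ _ V≡W _ = ⊥-elim (V≢W V≡W)
  ... | tri> _ _ W<V = 0 , trans (+-comm (β V) W) (sym (offset-before W<V))

  offset-mono-after : ∀ {V W W′} → V < W → W ≤ W′ → offset V W ≤ offset V W′
  offset-mono-after {V} V<W W≤W′ = +-cancelˡ-≤ (suc V) _ _
    (subst₂ _≤_ (sym (offset-after V<W)) (sym (offset-after (<-≤-trans V<W W≤W′))) W≤W′)

  offset-mono-before : ∀ {V W W′} → W ≤ W′ → W′ < V → offset V W ≤ offset V W′
  offset-mono-before {V} W≤W′ W′<V = subst₂ _≤_ (sym (offset-before (≤-<-trans W≤W′ W′<V)))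
    (sym (offset-before W′<V)) (+-monoˡ-≤ (β V) W≤W′)

  offset-injective : ∀ {V W W′} → W ≤ n-1 → W′ ≤ n-1 → V ≢ W → V ≢ W′ → offset V W ≡ offset V W′ → W ≡ W′
  offset-injective {V} {W} {W′} W≤ W′≤ V≢W V≢W′ eq with <-cmp V W | <-cmp V W′
  ... | tri≈ _ V≡W _ | _              = ⊥-elim (V≢W V≡W)
  ... | _              | tri≈ _ V≡W′ _ = ⊥-elim (V≢W′ V≡W′)
  ... | tri< V<W _ _ | tri< V<W′ _ _  =
    trans (sym (offset-after V<W)) (trans (cong (suc V +_) eq) (offset-after V<W′))
  ... | tri> _ _ W<V | tri> _ _ W′<V  =
    +-cancelʳ-≡ (β V) W W′ (trans (sym (offset-before W<V)) (trans eq (offset-before W′<V)))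
  ... | tri< V<W _ _ | tri> _ _ W′<V  =
    ⊥-elim (<-irrefl eq (<-≤-trans (offset-after<β V<W W≤) (β≤offset-before W′<V)))
  ... | tri> _ _ W<V | tri< V<W′ _ _  =
    ⊥-elim (<-irrefl (sym eq) (<-≤-trans (offset-after<β V<W′ W′≤) (β≤offset-before W<V)))

  -- A vertex x = (v, vw) of Ec(K n) sits at its home v; away x is the other end w of its edge.
  Vertex : Set
  Vertex = Vtx (Ec (K n))

  home away : Vertex → ℕ
  home (v , _ , _) = toℕ v
  away (_ , w , _) = toℕ w

  home≤ : ∀ x → home x ≤ n-1
  home≤ (v , _ , _) = s≤s⁻¹ (toℕ<n v)

  away≤ : ∀ x → away x ≤ n-1
  away≤ (_ , w , _) = s≤s⁻¹ (toℕ<n w)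

  home≢away : ∀ x → home x ≢ away x
  home≢away (_ , _ , vw) = K-distinct vw ∘ toℕ-injective

  block off : Vertex → ℕ
  block x = β (home x)
  off x   = offset (home x) (away x)

  off<n : ∀ x → off x < n
  off<n x = <-trans (offset<n-1 (home≤ x) (away≤ x) (home≢away x)) (n<1+n n-1)

  position : Vertex → ℕ
  position x = n * block x + off x

  block-mono : ∀ x y → position x < position y → block x ≤ block y
  block-mono x y = lex-block n (off<n y)

  home-antitone : ∀ x y → position x < position y → home y ≤ home x
  home-antitone x y lt = β-reflects (home≤ y) (block-mono x y lt)

  off-< : ∀ x y → home x ≡ home y → position x < position y → off x < off y
  off-< x y same lt = +-cancelˡ-< (n * block x) _ _ (subst (λ b → position x < n * b + off y) (cong β (sym same)) lt)

  squeezed : ∀ x y u → home x ≡ home y → position x < position u → position u < position y → home u ≡ home x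
  squeezed x y u same xu uy = ≤-antisym (home-antitone x u xu) (subst (_≤ home u) (sym same) (home-antitone u y uy))

  off<n-1 : ∀ x → off x < n-1
  off<n-1 x = offset<n-1 (home≤ x) (away≤ x) (home≢away x)

  off-mono-before : ∀ x u → home u ≡ home x → away u ≤ away x → away x < home x → off u ≤ off x
  off-mono-before x u same au≤ax ax<hx =
    subst (λ V → offset V (away u) ≤ off x) (sym same) (offset-mono-before au≤ax ax<hx)

  off-mono-after : ∀ x u → home u ≡ home x → home x < away u → away u ≤ away x → off u ≤ off x
  off-mono-after x u same hx<au au≤ax =
    subst (λ V → offset V (away u) ≤ off x) (sym same) (offset-mono-after hx<au au≤ax)

  off-after<before : ∀ x u → home u ≡ home x → home x < away x → away u < home x → off x < off u
  off-after<before x u same hx<ax au<hx = subst (λ V → off x < offset V (away u)) (sym same)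
    (<-≤-trans (offset-after<β hx<ax (away≤ x)) (β≤offset-before au<hx))

  -- Shifting label sums by twice the block index turns them into offset sums, modulo n.
  wrap : ∀ x → Σ[ k ∈ ℕ ] block x + away x ≡ k * n + off x
  wrap x = offset-mod (home≤ x) (home≢away x)

  clique-shift : ∀ x y → home y ≡ home x → Pg ((block x + block x) + (away x + away y)) ≡ Pg (off x + off y)
  clique-shift x y same with wrap x | wrap y
  ... | kx , ex | ky , ey = trans (cong Pg sum) (half-mod-period m (kx + ky) (off x + off y))
    where
    open ≡-Reasoning
    b = block x
    ey′ : b + away y ≡ ky * n + off y
    ey′ = subst (λ V → β V + away y ≡ ky * n + off y) same ey
    sum : (b + b) + (away x + away y) ≡ (kx + ky) * n + (off x + off y)
    sum = begin
      (b + b) + (away x + away y)               ≡⟨ interchange b b (away x) (away y) ⟩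
      (b + away x) + (b + away y)               ≡⟨ cong₂ _+_ ex ey′ ⟩
      (kx * n + off x) + (ky * n + off y)       ≡⟨ interchange (kx * n) (off x) (ky * n) (off y) ⟩
      (kx * n + ky * n) + (off x + off y)       ≡⟨ cong (_+ (off x + off y)) (*-distribʳ-+ n kx ky) ⟨
      (kx + ky) * n + (off x + off y)           ∎

  matching-shift : ∀ x → Pg ((block x + block x) + (home x + away x)) ≡ Pg (off x + n-1)
  matching-shift x with wrap x
  ... | k , e = trans (cong Pg sum) (half-mod-period m k (off x + n-1))
    where
    open ≡-Reasoning
    b = block x
    sum : (b + b) + (home x + away x) ≡ k * n + (off x + n-1)
    sum = begin
      (b + b) + (home x + away x) ≡⟨ interchange b b (home x) (away x) ⟩
      (b + home x) + (b + away x) ≡⟨ cong₂ _+_ (trans (+-comm b (home x)) (β-complement (home≤ x))) e ⟩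
      n-1 + (k * n + off x)       ≡⟨ +-comm n-1 (k * n + off x) ⟩
      (k * n + off x) + n-1       ≡⟨ +-assoc (k * n) (off x) n-1 ⟩
      k * n + (off x + n-1)       ∎

  transport : ∀ x u {s s′} → home u ≡ home x → Pg s ≡ Pg s′ →
              Pg ((block x + block x) + s) ≡ Pg ((block u + block u) + s′)
  transport x u {s′ = s′} same eq = trans (half-mod-shift m (block x) eq) (cong (λ b → Pg ((b + b) + s′)) (cong β (sym same)))

  clique-clique : ∀ x y u z → home y ≡ home x → home z ≡ home u →
                  position x < position u → position u < position y → position y < position z →
                  Pg (away x + away y) ≢ Pg (away u + away z)
  clique-clique x y u z hy hz xu uy yz same =
    zigzag m (off-< x u (sym hu) xu) (off-< u y (trans hu (sym hy)) uy)
             (off-< y z (trans hy (trans (sym hu) (sym hz))) yz) (off<n z) (begin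
      Pg (off x + off y)                          ≡⟨ clique-shift x y hy ⟨
      Pg ((block x + block x) + (away x + away y)) ≡⟨ transport x u hu same ⟩
      Pg ((block u + block u) + (away u + away z)) ≡⟨ clique-shift u z hz ⟩
      Pg (off u + off z)                          ∎)
    where
    open ≡-Reasoning
    hu : home u ≡ home x
    hu = squeezed x y u (sym hy) xu uy

  clique-matching : ∀ x y u → home y ≡ home x → position x < position u → position u < position y →
                    Pg (away x + away y) ≢ Pg (home u + away u)
  clique-matching x y u hy xu uy same =
    zigzag m (off-< x u (sym hu) xu) (off-< u y (trans hu (sym hy)) uy) (off<n-1 y) (n<1+n n-1) (begin
      Pg (off x + off y)                          ≡⟨ clique-shift x y hy ⟨
      Pg ((block x + block x) + (away x + away y)) ≡⟨ transport x u hu same ⟩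
      Pg ((block u + block u) + (home u + away u)) ≡⟨ matching-shift u ⟩
      Pg (off u + n-1)                            ∎)
    where
    open ≡-Reasoning
    hu : home u ≡ home x
    hu = squeezed x y u (sym hy) xu uy

  -- Their four homes are weakly decreasing
  -- along the spine; equal homes contradict the cyclic order inside a block, and four
  -- different homes alternate in K n, where the zig-zag assignment separates them.
  matching-matching : ∀ x y u z → home y ≡ away x → away y ≡ home x → home z ≡ away u → away z ≡ home u →
                      position x < position u → position u < position y → position y < position z →
                      Pg (home x + home y) ≢ Pg (home u + home z)
  matching-matching x y u z hy ay hz az xu uy yz =
    decreasing (home-antitone x u xu) (subst (_≤ home u) hy (home-antitone u y uy))
               (subst₂ _≤_ hz hy (home-antitone y z yz))
    where
    decreasing : home u ≤ home x → away x ≤ home u → away u ≤ away x →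
                 Pg (home x + home y) ≢ Pg (home u + home z)
    decreasing V₂≤V₁ W₁≤V₂ W₂≤W₁ same with m≤n⇒m<n∨m≡n V₂≤V₁
    ... | inj₂ V₂≡V₁ = <⇒≱ (off-< x u (sym V₂≡V₁) xu) (off-mono-before x u V₂≡V₁ W₂≤W₁ W₁<V₁)
      where
      W₁<V₁ : away x < home x
      W₁<V₁ = ≤∧≢⇒< (≤-trans W₁≤V₂ V₂≤V₁) (home≢away x ∘ sym)
    ... | inj₁ V₂<V₁ with m≤n⇒m<n∨m≡n W₁≤V₂
    ...   | inj₂ W₁≡V₂ = <-asym (off-< u y hu≡hy uy) (off-after<before y u hu≡hy hy<ay au<hy)
      where
      hy≡hu : home y ≡ home u
      hy≡hu = trans hy W₁≡V₂
      hu≡hy : home u ≡ home y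
      hu≡hy = sym hy≡hu
      hy<ay : home y < away y
      hy<ay = subst₂ _<_ hu≡hy (sym ay) V₂<V₁
      au<hy : away u < home y
      au<hy = subst (away u <_) hu≡hy (≤∧≢⇒< (≤-trans W₂≤W₁ W₁≤V₂) (home≢away u ∘ sym))
    ...   | inj₁ W₁<V₂ with m≤n⇒m<n∨m≡n W₂≤W₁
    ...     | inj₂ W₂≡W₁ = <⇒≱ (off-< y z (sym hz≡hy) yz)
                              (off-mono-after y z hz≡hy (subst₂ _<_ (sym hy) (sym az) W₁<V₂)
                                                        (subst₂ _≤_ (sym az) (sym ay) V₂≤V₁))
      where
      hz≡hy : home z ≡ home y
      hz≡hy = trans hz (trans W₂≡W₁ (sym hy))
    ...     | inj₁ W₂<W₁ = zigzag m W₂<W₁ W₁<V₂ V₂<V₁ (s≤s (home≤ x)) (begin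
        Pg (away u + home u) ≡⟨ cong Pg (+-comm (away u) (home u)) ⟩
        Pg (home u + away u) ≡⟨ cong (λ w → Pg (home u + w)) hz ⟨
        Pg (home u + home z) ≡⟨ same ⟨
        Pg (home x + home y) ≡⟨ cong (λ w → Pg (home x + w)) hy ⟩
        Pg (home x + away x) ≡⟨ cong Pg (+-comm (home x) (away x)) ⟩
        Pg (away x + home x) ∎)
      where open ≡-Reasoning

  position-injective : ∀ x y → position x ≡ position y → x ≡ y
  position-injective x y eq with lex-injective n (off<n x) (off<n y) eq
  ... | same-block , same-off = Ec-vertex-≡ x y (toℕ-injective same-home) (toℕ-injective same-away)
    where
    same-home : home x ≡ home y
    same-home = β-injective (home≤ x) (home≤ y) same-block
    same-away : away x ≡ away y
    same-away = offset-injective (away≤ x) (away≤ y) (home≢away x) (subst (_≢ away y) (sym same-home) (home≢away y))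
                  (trans same-off (cong (λ V → offset V (away y)) (sym same-home)))

  page-of : ℕ → Fin m
  page-of s = ⌊ s /2⌋ mod m

  page-of-≡ : ∀ s s′ → page-of s ≡ page-of s′ → Pg s ≡ Pg s′
  page-of-≡ s s′ eq = trans (sym (toℕ-fromℕ< _)) (trans (cong toℕ eq) (toℕ-fromℕ< _))

  page : ∀ x y → Adj (Ec (K n)) x y → Fin m
  page x y (inj₁ _) = page-of (away x + away y)
  page x y (inj₂ _) = page-of (home x + home y)

  -- the four kinds of pairs of edges; a matching edge (v, vw)(v′, v′w′) has v ≡ w′ and w ≡ v′
  noCross : ∀ x y u z (a : Adj (Ec (K n)) x y) (b : Adj (Ec (K n)) u z) →
            page x y a ≡ page u z b → ¬ Crossing position x y u z
  noCross x y u z (inj₁ (x≡y , _)) (inj₁ (u≡z , _)) same (xu , uy , yz) =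
    clique-clique x y u z (cong toℕ (sym x≡y)) (cong toℕ (sym u≡z)) xu uy yz
      (page-of-≡ (away x + away y) (away u + away z) same)
  noCross x y u z (inj₁ (x≡y , _)) (inj₂ (_ , u′≡z)) same (xu , uy , _) =
    clique-matching x y u (cong toℕ (sym x≡y)) xu uy (begin
      Pg (away x + away y) ≡⟨ page-of-≡ (away x + away y) (home u + home z) same ⟩
      Pg (home u + home z) ≡⟨ cong (λ w → Pg (home u + w)) (cong toℕ (sym u′≡z)) ⟩
      Pg (home u + away u) ∎)
    where open ≡-Reasoning
  noCross x y u z (inj₂ (x≡y′ , _)) (inj₁ (u≡z , _)) same (_ , uy , yz) =
    clique-matching u z y (cong toℕ (sym u≡z)) uy yz (begin
      Pg (away u + away z) ≡⟨ page-of-≡ (home x + home y) (away u + away z) same ⟨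
      Pg (home x + home y) ≡⟨ cong (λ w → Pg (w + home y)) (cong toℕ x≡y′) ⟩
      Pg (away y + home y) ≡⟨ cong Pg (+-comm (away y) (home y)) ⟩
      Pg (home y + away y) ∎)
    where open ≡-Reasoning
  noCross x y u z (inj₂ (x≡y′ , x′≡y)) (inj₂ (u≡z′ , u′≡z)) same (xu , uy , yz) =
    matching-matching x y u z (cong toℕ (sym x′≡y)) (cong toℕ (sym x≡y′)) (cong toℕ (sym u′≡z)) (cong toℕ (sym u≡z′))
      xu uy yz (page-of-≡ (home x + home y) (home u + home z) same)

  embedding : BookEmbedding (Ec (K (m + m))) m
  embedding = record { pos = position ; pos-inj = position-injective ; page = page ; noCross = noCross }

2*[1+m]≡[1+m]+[1+m] : ∀ M → 2 * suc M ≡ suc M + suc M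
2*[1+m]≡[1+m]+[1+m] = solve-∀

2*[1+m]≡2+[m+m] : ∀ M → 2 * suc M ≡ suc (suc (M + M))
2*[1+m]≡2+[m+m] = solve-∀

2*m+1≡1+[m+m] : ∀ m → 2 * m + 1 ≡ suc (m + m)
2*m+1≡1+[m+m] = solve-∀

1+[2*[1+m]+1]≡2*[2+m] : ∀ M → suc (2 * suc M + 1) ≡ 2 * suc (suc M)
1+[2*[1+m]+1]≡2*[2+m] = solve-∀

clique-book : ∀ {N k} → BookEmbedding (Ec (K (suc N))) k → SpineBook N k
clique-book = spine-book ∘ restrict (vertex-clique _)

resize : ∀ {n n′ k} → n ≡ n′ → BookEmbedding (Ec (K n)) k → BookEmbedding (Ec (K n′)) k
resize {k = k} eq = subst (λ N → BookEmbedding (Ec (K N)) k) eq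

even-upper : ∀ M → BookEmbedding (Ec (K (2 * suc M))) (suc M)
even-upper M = resize (sym (2*[1+m]≡[1+m]+[1+m] M)) (EvenEmbedding.embedding M)

odd-upper : ∀ M → BookEmbedding (Ec (K (2 * suc M + 1))) (suc M + 1)
odd-upper M = subst (BookEmbedding _) (+-comm 1 (suc M))
  (restrict (Ec-K-mono (subst (2 * suc M + 1 ≤_) (1+[2*[1+m]+1]≡2*[2+m] M) (n≤1+n _))) (even-upper (suc M)))

-- pn(Ec(K_{2m})) ≥ m: an edge for m = 1, the one-page argument for m = 2,
-- and the clique K_{2m-1} at a vertex for m ≥ 3.
even-lower : ∀ M k → BookEmbedding (Ec (K (2 * suc M))) k → suc M ≤ k
even-lower zero                k E = edge⇒page (Ec-edge 0) E
even-lower (suc zero)          k E = Ec-two-pages 0 k E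
even-lower M@(suc (suc _))     k E = clique-odd (s≤s (s≤s z≤n)) (clique-book (resize (2*[1+m]≡2+[m+m] M) E))

-- pn(Ec(K_{2m+1})) ≥ m: the clique K_{2m} at a vertex.
odd-lower : ∀ m k → BookEmbedding (Ec (K (2 * m + 1))) k → m ≤ k
odd-lower m k E = clique-even (clique-book (resize (2*m+1≡1+[m+m] m) E))

theorem3p7 : (m : ℕ) → 1 ≤ m →
    PagenumberIs (Ec (K (2 * m))) m ×
    PagenumberBetween (Ec (K (2 * m + 1))) m (m + 1)
theorem3p7 zero    ()
theorem3p7 (suc M) _  = (even-upper M , even-lower M) , (odd-upper M , odd-lower (suc M))
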